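{- Let $G=(A,B,E)$ be a finite bipartite graph of linearity $c\ge 1$ and let $N\ge|A|$. Let $W\subseteq A$ be a subset of size $\lceil|A|/(2c^2)\rceil$ chosen uniformly at random among all subsets of that size. Then the probability that there exist $b,b'\in B$ with $N(b)\cap W=N(b')\cap W$ and $|N(b)\triangle N(b')|\ge 6c^2\log N$ is at most $c^2/N$.
   Context: $N(v)$ denotes the neighborhood of $v$ in $G$ (the symbol $N$ without argument denotes the number given in the statement). Two vertices on the same side are twins (in a given graph) if they have the same neighborhood. For $A''\subseteq A$, $B''\subseteq B$, $G[A'',B'']$ is the induced subgraph. Define $\pi_G(n)=\max_{A''\subseteq A,|A''|\le n}$ (number of twin classes of $B$ in $G[A'',B]$) and $\pi^*_G(n)=\max_{B''\subseteq B,|B''|\le n}$ (number of twin classes of $A$ in $G[A,B'']$). The linearity of $G$ is the smallest $c\ge1$ with $\pi_G(k),\pi^*_G(k)\le ck$ for all $k$. Logarithms are base 2. -}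

module Defs where

open import Data.Bool.Base using (Bool; true; false; _∧_; _xor_; T)
open import Data.Nat.Base as ℕ using (ℕ; zero; suc; _⊔_; _^_; _≤ᵇ_)
open import Data.Fin.Base using (Fin)
open import Data.Fin.Subset using (Subset; inside; outside; ∣_∣)
open import Data.Vec.Base using (Vec; []; _∷_; lookup; tabulate)
open import Data.Vec.Properties using (≡-dec)
open import Data.List.Base using (List; []; _∷_; [_]; map; _++_; filter; length; deduplicate; foldr; allFin)
open import Data.Bool.ListAction using (any)
import Data.Bool.Properties as BoolP
import Data.Nat.Properties as ℕP
open import Data.Integer.Base using (+_)
import Data.Integer.Base as ℤ
open import Data.Rational.Base using (ℚ; _≤_; _*_; _÷_; 1ℚ; 0ℚ; ↥_; ↧ₙ_; ceiling; NonZero; positive; *<*)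
open import Data.Rational.Properties using (<-≤-trans; pos⇒nonZero)
open import Data.Product.Base using (_×_; proj₁)
open import Relation.Nullary.Decidable.Core using (isYes; T?)
open import Function.Base using (_∘_)

-- A finite bipartite graph G = (A, B, E) with A = Fin n, B = Fin m,
-- given by its (Boolean) adjacency relation  E a b  (a ∈ A, b ∈ B).
Adj : ℕ → ℕ → Set
Adj n m = Fin n → Fin m → Bool

transpose : ∀ {n m} → Adj n m → Adj m n
transpose E b a = E a b

toℚ : ℕ → ℚ
toℚ k = + k Data.Rational.Base./ 1

allSubsets : (n : ℕ) → List (Subset n)
allSubsets zero = [ [] ]
allSubsets (suc n) = map (inside ∷_) (allSubsets n) ++ map (outside ∷_) (allSubsets n)

trace : ∀ {n m} → Adj n m → Subset n → Fin m → Subset n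
trace E A'' b = tabulate (λ a → lookup A'' a ∧ E a b)

-- number of twin classes of B in G[A'', B]
-- (= number of distinct sets N(b) ∩ A'', b ∈ B)
twinClassesB : ∀ {n m} → Adj n m → Subset n → ℕ
twinClassesB {n} {m} E A'' =
  length (deduplicate (≡-dec BoolP._≟_) (map (trace E A'') (allFin m)))

π : ∀ {n m} → Adj n m → ℕ → ℕ
π {n} E k =
  foldr _⊔_ 0 (map (twinClassesB E) (filter (λ A'' → ∣ A'' ∣ ℕP.≤? k) (allSubsets n)))

π* : ∀ {n m} → Adj n m → ℕ → ℕ
π* E k = π (transpose E) k

LinBound : ∀ {n m} → Adj n m → ℚ → Set
LinBound E c = ∀ k → 1 ℕ.≤ k →
  (toℚ (π E k) ≤ c * toℚ k) × (toℚ (π* E k) ≤ c * toℚ k)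

IsLinearity : ∀ {n m} → Adj n m → ℚ → Set
IsLinearity E c =
  (1ℚ ≤ c) × LinBound E c × (∀ c' → 1ℚ ≤ c' → LinBound E c' → c ≤ c')

≥1⇒nonZero : ∀ {c} → 1ℚ ≤ c → NonZero c
≥1⇒nonZero {c} h = pos⇒nonZero c {{positive (<-≤-trans {0ℚ} {1ℚ} {c} (*<* (ℤ.+<+ (ℕ.s≤s ℕ.z≤n))) h)}}

wsize : ℕ → (c : ℚ) → 1ℚ ≤ c → ℕ
wsize n c h = ℤ.∣ ceiling (((toℚ n ÷ c) ÷ c) ÷ toℚ 2) ∣
  where instance
    nz : NonZero c
    nz = ≥1⇒nonZero h

symDiff : ∀ {n m} → Adj n m → Fin m → Fin m → ℕ
symDiff {n} E b b' = length (filter (λ a → T? (E a b xor E a b')) (allFin n))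

-- For N ≥ 1 and c = p/q (p = numerator, q = denominator):
--   d ≥ 6 c² log₂ N   ⇔   N ^ (6 c²) ≤ 2 ^ d   ⇔   N ^ (6 p²) ≤ 2 ^ (d q²)
logBoundᵇ : ℚ → ℕ → ℕ → Bool
logBoundᵇ c N d = (N ^ (6 ℕ.* p ℕ.* p)) ≤ᵇ (2 ^ (d ℕ.* q ℕ.* q))
  where
  p = ℤ.∣ ↥ c ∣
  q = ↧ₙ c

badᵇ : ∀ {n m} → Adj n m → ℚ → ℕ → Subset n → Bool
badᵇ {n} {m} E c N W =
  any (λ b → any (λ b' →
         isYes (≡-dec BoolP._≟_ (trace E W b) (trace E W b'))
         ∧ logBoundᵇ c N (symDiff E b b'))
       (allFin m)) (allFin m)

-- sample space: all subsets of A of size s (W chosen uniformly among them)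
subsetsOfSize : (n s : ℕ) → List (Subset n)
subsetsOfSize n s = filter (λ W → ∣ W ∣ ℕP.≟ s) (allSubsets n)

badCount : ∀ {n m} → Adj n m → ℚ → ℕ → ℕ → ℕ
badCount {n} E c N s = length (filter (λ W → T? (badᵇ E c N W)) (subsetsOfSize n s))

{-# OPTIONS --safe #-}
module Submission where

-- N(b) ∩ W = N(b′) ∩ W exactly when W avoids D = N(b) △ N(b′). If |D| = d, a uniform W of size s
-- avoids D with probability C(n − d, s) / C(n, s) ≤ ((n − s) / n)^d. Writing c = p / q, a = 2p² and
-- t = q², the choice s ≥ n / (2c²) bounds this by (1 − t / a)^d, and the discrete inequality
-- 2^t (a − t)^a ≤ a^a (a form of (1 − t / a)^a ≤ 2^(−t)) turns d ≥ 6c² log N, i.e. N^(3a) ≤ 2^(dt),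
-- into the bound N^(−3). Only pairs of distinct neighbourhoods matter; there are at most π(N) ≤ cN
-- of them, so a union bound over pairs gives probability at most (cN)² / N³ = c² / N.

open import Defs

module Counting where

  open import Level using (Level)
  open import Data.Empty using (⊥-elim)
  open import Data.Unit.Base using (tt)
  open import Function.Base using (_∘_)
  open import Data.Bool.Base using (Bool; true; false; _∧_; _∨_; T)
  open import Data.Bool.ListAction using (any)
  open import Data.Nat.Base
  open import Data.Nat.Properties
  open import Data.List.Base using (List; []; _∷_; _++_; map; filter; filterᵇ; length)
  open import Data.List.Properties using (length-++; filter-++)
  open import Relation.Binary.PropositionalEquality
  open import Relation.Nullary.Decidable.Core using (does; T?)
  open import Relation.Unary using (Pred; Decidable)

  private
    variable
      a ℓ : Level
      A I : Set a

  count : (A → Bool) → List A → ℕ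
  count p = length ∘ filterᵇ p

  count-++ : ∀ (p : A → Bool) xs ys → count p (xs ++ ys) ≡ count p xs + count p ys
  count-++ p xs ys = trans (cong length (filter-++ (T? ∘ p) xs ys)) (length-++ (filterᵇ p xs))

  count-map : ∀ {B : Set a} (p : B → Bool) (f : A → B) xs → count p (map f xs) ≡ count (p ∘ f) xs
  count-map p f [] = refl
  count-map p f (x ∷ xs) with p (f x)
  ... | true  = cong suc (count-map p f xs)
  ... | false = count-map p f xs

  count-cong : ∀ {p q : A → Bool} → p ≗ q → ∀ xs → count p xs ≡ count q xs
  count-cong eq [] = refl
  count-cong {p = p} {q} eq (x ∷ xs) with p x | q x | eq x
  ... | true  | .true  | refl = cong suc (count-cong eq xs)
  ... | false | .false | refl = count-cong eq xs

  count-none : ∀ (p : A → Bool) → (∀ x → p x ≡ false) → ∀ xs → count p xs ≡ 0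
  count-none p none [] = refl
  count-none p none (x ∷ xs) with p x | none x
  ... | false | refl = count-none p none xs

  count-mono : ∀ {p q : A → Bool} → (∀ x → T (p x) → T (q x)) → ∀ xs → count p xs ≤ count q xs
  count-mono p⇒q [] = z≤n
  count-mono {p = p} {q} p⇒q (x ∷ xs) with p x | q x | p⇒q x
  ... | true  | true  | _  = s≤s (count-mono p⇒q xs)
  ... | false | true  | _  = m≤n⇒m≤1+n (count-mono p⇒q xs)
  ... | false | false | _  = count-mono p⇒q xs
  ... | true  | false | pq = ⊥-elim (pq tt)

  count-∨ : ∀ (p q : A → Bool) xs → count (λ x → p x ∨ q x) xs ≤ count p xs + count q xs
  count-∨ p q [] = z≤n
  count-∨ p q (x ∷ xs) with p x | q x
  ... | true  | true  = s≤s (≤-trans (count-∨ p q xs) (+-monoʳ-≤ (count p xs) (n≤1+n _)))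
  ... | true  | false = s≤s (count-∨ p q xs)
  ... | false | true  = ≤-trans (s≤s (count-∨ p q xs)) (≤-reflexive (sym (+-suc _ _)))
  ... | false | false = count-∨ p q xs

  count-any-≤ : ∀ (q : I → A → Bool) is xs {M B} → (∀ i → count (q i) xs * M ≤ B) →
    count (λ x → any (λ i → q i x) is) xs * M ≤ length is * B
  count-any-≤ q [] xs {M} _ = ≤-reflexive (cong (_* M) (count-none (λ _ → false) (λ _ → refl) xs))
  count-any-≤ q (i ∷ is) xs {M} {B} bound = begin
    count (λ x → q i x ∨ any (λ j → q j x) is) xs * M
      ≤⟨ *-monoˡ-≤ M (count-∨ (q i) (λ x → any (λ j → q j x) is) xs) ⟩
    (count (q i) xs + count (λ x → any (λ j → q j x) is) xs) * M
      ≡⟨ *-distribʳ-+ M (count (q i) xs) _ ⟩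
    count (q i) xs * M + count (λ x → any (λ j → q j x) is) xs * M
      ≤⟨ +-mono-≤ (bound i) (count-any-≤ q is xs bound) ⟩
    B + length is * B ∎
    where open ≤-Reasoning

  length-filter≡count : ∀ {P : Pred A ℓ} (P? : Decidable P) xs → length (filter P? xs) ≡ count (does ∘ P?) xs
  length-filter≡count P? [] = refl
  length-filter≡count P? (x ∷ xs) with does (P? x)
  ... | true  = cong suc (length-filter≡count P? xs)
  ... | false = length-filter≡count P? xs

  count-filter : ∀ {P : Pred A ℓ} (P? : Decidable P) (p : A → Bool) xs →
    count p (filter P? xs) ≡ count (λ x → does (P? x) ∧ p x) xs
  count-filter P? p [] = refl
  count-filter P? p (x ∷ xs) with does (P? x)
  ... | false = count-filter P? p xs
  ... | true with p x
  ...   | true  = cong suc (count-filter P? p xs)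
  ...   | false = count-filter P? p xs

  count-∧ˡ-≤ : ∀ b (p : A → Bool) xs {M B} → (T b → count p xs * M ≤ B) →
    count (λ x → b ∧ p x) xs * M ≤ B
  count-∧ˡ-≤ true  p xs     bound = bound tt
  count-∧ˡ-≤ false p xs {M} _     =
    ≤-trans (≤-reflexive (cong (_* M) (count-none (λ _ → false) (λ _ → refl) xs))) z≤n

module SubsetCounting where

  open Counting
  open import Function.Base using (_∘_)
  open import Function.Bundles using (Equivalence)
  open import Data.Bool.Base using (Bool; true; false; _∧_; _xor_; T)
  import Data.Bool.Properties as Bool
  open import Data.Nat.Base
  open import Data.Nat.Properties
  open import Data.Nat.Combinatorics using (_C_; nCk+nC[k+1]≡[n+1]C[k+1])
  open import Data.Fin.Subset using (Subset; inside; outside; ⊥; _∩_; ∣_∣)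
  open import Data.Fin.Subset.Properties using (∣p∣≤n)
  open import Data.Fin.Base using (Fin; zero; suc)
  open import Data.Vec.Base as Vec using ([]; _∷_; zipWith)
  open import Data.Vec.Properties using (≡-dec)
  open import Data.List.Base as List using (map)
  open import Data.List.Membership.Propositional using (_∈_)
  open import Data.List.Membership.Propositional.Properties using (∈-map⁺; ∈-++⁺ˡ; ∈-++⁺ʳ)
  open import Data.List.Relation.Unary.Any using (here)
  open import Relation.Binary.PropositionalEquality
  open import Relation.Nullary.Decidable using (does; dec-true)

  private
    variable
      n : ℕ

  _△_ : Subset n → Subset n → Subset n
  p △ q = zipWith _xor_ p q

  ∣p△p∣≡0 : ∀ (p : Subset n) → ∣ p △ p ∣ ≡ 0
  ∣p△p∣≡0 []      = refl
  ∣p△p∣≡0 (x ∷ p) rewrite Bool.xor-same x = ∣p△p∣≡0 p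

  count-tabulate : ∀ {A : Set} (p : A → Bool) (f : Fin n → A) →
    count p (List.tabulate f) ≡ ∣ Vec.tabulate (p ∘ f) ∣
  count-tabulate {zero}  p f = refl
  count-tabulate {suc n} p f with p (f zero)
  ... | true  = cong suc (count-tabulate p (f ∘ suc))
  ... | false = count-tabulate p (f ∘ suc)

  -- `does` rather than `isYes`, so that both predicates compute on `inside ∷ W` and `outside ∷ W`.
  sized : ℕ → Subset n → Bool
  sized s W = does (∣ W ∣ ≟ s)

  agreeOn : Subset n → Subset n → Subset n → Bool
  agreeOn W X Y = does (≡-dec Bool._≟_ (W ∩ X) (W ∩ Y))

  ∈-allSubsets : ∀ (p : Subset n) → p ∈ allSubsets n
  ∈-allSubsets []            = here refl
  ∈-allSubsets (inside ∷ p)  = ∈-++⁺ˡ (∈-map⁺ (inside ∷_) (∈-allSubsets p))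
  ∈-allSubsets (outside ∷ p) =
    ∈-++⁺ʳ (map (inside ∷_) (allSubsets _)) (∈-map⁺ (outside ∷_) (∈-allSubsets p))

  count-allSubsets-suc : ∀ (p : Subset (suc n) → Bool) → count p (allSubsets (suc n)) ≡
    count (p ∘ (inside ∷_)) (allSubsets n) + count (p ∘ (outside ∷_)) (allSubsets n)
  count-allSubsets-suc {n} p = trans (count-++ p (map (inside ∷_) S) (map (outside ∷_) S))
    (cong₂ _+_ (count-map p (inside ∷_) S) (count-map p (outside ∷_) S))
    where S = allSubsets n

  count-sized-agreeOn : ∀ n (X Y : Subset n) s →
    count (λ W → sized s W ∧ agreeOn W X Y) (allSubsets n) ≡ (n ∸ ∣ X △ Y ∣) C s
  count-sized-agreeOn zero    []      []      zero    = refl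
  count-sized-agreeOn zero    []      []      (suc s) = refl
  count-sized-agreeOn (suc n) (x ∷ X) (y ∷ Y) s =
    trans (count-allSubsets-suc (λ W → sized s W ∧ agreeOn W (x ∷ X) (y ∷ Y))) (split x y s)
    where
    S = allSubsets n
    d = ∣ X △ Y ∣
    IH = count-sized-agreeOn n X Y
    separated : ∀ s → count (λ W → sized s (inside ∷ W) ∧ false) S ≡ 0
    separated s = count-none _ (λ W → Bool.∧-zeroʳ (sized s (inside ∷ W))) S
    [1+n]∸d : suc n ∸ d ≡ suc (n ∸ d)
    [1+n]∸d = +-∸-assoc 1 (∣p∣≤n (X △ Y))
    same : ∀ s → (n ∸ d) C s + (n ∸ d) C suc s ≡ (suc n ∸ d) C suc s
    same s = trans (nCk+nC[k+1]≡[n+1]C[k+1] (n ∸ d) s) (cong (_C suc s) (sym [1+n]∸d))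
    split : ∀ x y s → count (λ W → sized s (inside ∷ W) ∧ agreeOn (inside ∷ W) (x ∷ X) (y ∷ Y)) S
                    + count (λ W → sized s W ∧ agreeOn W X Y) S ≡ (suc n ∸ ∣ (x ∷ X) △ (y ∷ Y) ∣) C s
    split true  false s       = cong₂ _+_ (separated s) (IH s)
    split false true  s       = cong₂ _+_ (separated s) (IH s)
    split true  true  zero    = cong₂ _+_ (count-none (λ _ → false) (λ _ → refl) S) (IH zero)
    split false false zero    = cong₂ _+_ (count-none (λ _ → false) (λ _ → refl) S) (IH zero)
    split true  true  (suc s) = trans (cong₂ _+_ (IH s) (IH (suc s))) (same s)
    split false false (suc s) = trans (cong₂ _+_ (IH s) (IH (suc s))) (same s)

  count-sized : ∀ n s → count (sized s) (allSubsets n) ≡ n C s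
  count-sized n s = begin
    count (sized s) (allSubsets n)
      ≡⟨ count-cong agreeOn-⊥ (allSubsets n) ⟩
    count (λ W → sized s W ∧ agreeOn W ∅ ∅) (allSubsets n)
      ≡⟨ count-sized-agreeOn n ∅ ∅ s ⟩
    (n ∸ ∣ ∅ △ ∅ ∣) C s
      ≡⟨ cong (λ d → (n ∸ d) C s) (∣p△p∣≡0 ∅) ⟩
    n C s
      ∎
    where
    open ≡-Reasoning
    ∅ = ⊥ {n = n}
    agreeOn-⊥ : ∀ W → sized s W ≡ sized s W ∧ agreeOn W ∅ ∅
    agreeOn-⊥ W = sym (trans (cong (sized s W ∧_) (dec-true (≡-dec Bool._≟_ (W ∩ ∅) (W ∩ ∅)) refl))
                             (Bool.∧-identityʳ (sized s W)))

  agreeOn⁺ : ∀ {W X Y : Subset n} → W ∩ X ≡ W ∩ Y → T (agreeOn W X Y)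
  agreeOn⁺ W∩X≡W∩Y = Equivalence.from Bool.T-≡ (dec-true (≡-dec Bool._≟_ _ _) W∩X≡W∩Y)

module Binomial where

  open import Data.Nat.Base
  open import Data.Nat.Properties
  open import Data.Nat.Combinatorics using (_C_; nC1≡n; nCk+nC[k+1]≡[n+1]C[k+1])
  open import Algebra.Properties.CommutativeSemigroup *-commutativeSemigroup
    using (interchange; xy∙z≈xz∙y; xy∙z≈y∙xz; x∙yz≈y∙xz; x∙yz≈xz∙y)
  open import Data.Nat.Tactic.RingSolver using (solve-∀)
  open import Relation.Binary.PropositionalEquality

  [1+n]C[1+k] : ∀ n k → suc n C suc k ≡ n C k + n C suc k
  [1+n]C[1+k] n k = sym (nCk+nC[k+1]≡[n+1]C[k+1] n k)

  [1+k]*[1+n]C[1+k]≡[1+n]*nCk : ∀ n k → suc k * (suc n C suc k) ≡ suc n * (n C k)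
  [1+k]*[1+n]C[1+k]≡[1+n]*nCk n       zero    =
    trans (*-identityˡ (suc n C 1)) (trans (nC1≡n (suc n)) (sym (*-identityʳ (suc n))))
  [1+k]*[1+n]C[1+k]≡[1+n]*nCk zero    (suc k) = *-zeroʳ (suc (suc k))
  [1+k]*[1+n]C[1+k]≡[1+n]*nCk (suc n) (suc k) = begin
    suc (suc k) * (suc (suc n) C suc (suc k))       ≡⟨ cong (suc (suc k) *_) ([1+n]C[1+k] (suc n) (suc k)) ⟩
    suc (suc k) * (U + suc n C suc (suc k))         ≡⟨ *-distribˡ-+ (suc (suc k)) U (suc n C suc (suc k)) ⟩
    U + suc k * U + suc (suc k) * (suc n C suc (suc k))
      ≡⟨ cong₂ (λ x y → U + x + y) ([1+k]*[1+n]C[1+k]≡[1+n]*nCk n k)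
                                    ([1+k]*[1+n]C[1+k]≡[1+n]*nCk n (suc k)) ⟩
    U + suc n * (n C k) + suc n * (n C suc k)       ≡⟨ +-assoc U (suc n * (n C k)) (suc n * (n C suc k)) ⟩
    U + (suc n * (n C k) + suc n * (n C suc k))     ≡⟨ cong (U +_) (*-distribˡ-+ (suc n) (n C k) (n C suc k)) ⟨
    U + suc n * (n C k + n C suc k)                 ≡⟨ cong (λ x → U + suc n * x) ([1+n]C[1+k] n k) ⟨
    suc (suc n) * U                                 ∎
    where
    open ≡-Reasoning
    U = suc n C suc k

  nCk*[1+n]≡[1+n∸k]*[1+n]Ck : ∀ n k → (n C k) * suc n ≡ (suc n ∸ k) * (suc n C k)
  nCk*[1+n]≡[1+n∸k]*[1+n]Ck n zero    = *-comm 1 (suc n)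
  nCk*[1+n]≡[1+n∸k]*[1+n]Ck n (suc k) = sym (begin
    (n ∸ k) * T                                    ≡⟨ *-distribʳ-∸ T (suc n) (suc k) ⟩
    suc n * T ∸ suc k * T                          ≡⟨ cong (_∸ suc k * T) [1+n]*T ⟩
    suc k * T + suc n * (n C suc k) ∸ suc k * T    ≡⟨ m+n∸m≡n (suc k * T) (suc n * (n C suc k)) ⟩
    suc n * (n C suc k)                            ≡⟨ *-comm (suc n) (n C suc k) ⟩
    (n C suc k) * suc n                            ∎)
    where
    open ≡-Reasoning
    T = suc n C suc k
    [1+n]*T : suc n * T ≡ suc k * T + suc n * (n C suc k)
    [1+n]*T = begin
      suc n * T                                      ≡⟨ cong (suc n *_) ([1+n]C[1+k] n k) ⟩
      suc n * (n C k + n C suc k)                    ≡⟨ *-distribˡ-+ (suc n) (n C k) (n C suc k) ⟩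
      suc n * (n C k) + suc n * (n C suc k)
        ≡⟨ cong (_+ suc n * (n C suc k)) ([1+k]*[1+n]C[1+k]≡[1+n]*nCk n k) ⟨
      suc k * T + suc n * (n C suc k)                ∎

  [k∸s]*a≤k*b : ∀ {k n s a b} → k ≤ n → (n ∸ s) * a ≤ n * b → (k ∸ s) * a ≤ k * b
  [k∸s]*a≤k*b {zero}  {s = s} _ _ rewrite 0∸n≡0 s = z≤n
  [k∸s]*a≤k*b {suc k} {n} {s} {a} {b} k≤n ratio =
    *-cancelʳ-≤ ((suc k ∸ s) * a) (suc k * b) n {{>-nonZero (≤-trans (s≤s z≤n) k≤n)}} (begin
      (suc k ∸ s) * a * n   ≡⟨ xy∙z≈xz∙y (suc k ∸ s) a n ⟩
      (suc k ∸ s) * n * a   ≤⟨ *-monoˡ-≤ a [k∸s]*n≤[n∸s]*k ⟩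
      (n ∸ s) * suc k * a   ≡⟨ xy∙z≈y∙xz (n ∸ s) (suc k) a ⟩
      suc k * ((n ∸ s) * a) ≤⟨ *-monoʳ-≤ (suc k) ratio ⟩
      suc k * (n * b)       ≡⟨ x∙yz≈xz∙y (suc k) n b ⟩
      suc k * b * n         ∎)
    where
    open ≤-Reasoning
    [k∸s]*n≤[n∸s]*k : (suc k ∸ s) * n ≤ (n ∸ s) * suc k
    [k∸s]*n≤[n∸s]*k = begin
      (suc k ∸ s) * n       ≡⟨ *-distribʳ-∸ n (suc k) s ⟩
      suc k * n ∸ s * n     ≤⟨ ∸-monoʳ-≤ (suc k * n) (*-monoʳ-≤ s k≤n) ⟩
      suc k * n ∸ s * suc k ≡⟨ cong (_∸ s * suc k) (*-comm (suc k) n) ⟩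
      n * suc k ∸ s * suc k ≡⟨ *-distribʳ-∸ (suc k) n s ⟨
      (n ∸ s) * suc k       ∎

  -- C(k, s) / C(k + 1, s) = (k + 1 − s) / (k + 1) ≤ (n − s) / n ≤ b / a whenever k < n.
  module _ {n s a b : ℕ} (ratio : (n ∸ s) * a ≤ n * b) where

    kCs*a≤[1+k]Cs*b : ∀ {k} → suc k ≤ n → (k C s) * a ≤ (suc k C s) * b
    kCs*a≤[1+k]Cs*b {k} k<n = *-cancelʳ-≤ ((k C s) * a) (R * b) (suc k) (begin
      (k C s) * a * suc k     ≡⟨ xy∙z≈xz∙y (k C s) a (suc k) ⟩
      (k C s) * suc k * a     ≡⟨ cong (_* a) (nCk*[1+n]≡[1+n∸k]*[1+n]Ck k s) ⟩
      (suc k ∸ s) * R * a     ≡⟨ xy∙z≈y∙xz (suc k ∸ s) R a ⟩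
      R * ((suc k ∸ s) * a)   ≤⟨ *-monoʳ-≤ R ([k∸s]*a≤k*b {s = s} {a} k<n ratio) ⟩
      R * (suc k * b)         ≡⟨ x∙yz≈xz∙y R (suc k) b ⟩
      R * b * suc k           ∎)
      where
      open ≤-Reasoning
      R = suc k C s

    kCs*a^d≤[k+d]Cs*b^d : ∀ d k → k + d ≤ n → (k C s) * a ^ d ≤ ((k + d) C s) * b ^ d
    kCs*a^d≤[k+d]Cs*b^d zero    k _ rewrite +-identityʳ k = ≤-refl
    kCs*a^d≤[k+d]Cs*b^d (suc d) k k+d≤n = begin
      (k C s) * (a * a ^ d)           ≡⟨ *-assoc (k C s) a (a ^ d) ⟨
      (k C s) * a * a ^ d             ≤⟨ *-monoˡ-≤ (a ^ d) (kCs*a≤[1+k]Cs*b 1+k≤n) ⟩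
      (suc k C s) * b * a ^ d         ≡⟨ xy∙z≈y∙xz (suc k C s) b (a ^ d) ⟩
      b * ((suc k C s) * a ^ d)       ≤⟨ *-monoʳ-≤ b (kCs*a^d≤[k+d]Cs*b^d d (suc k) 1+k+d≤n) ⟩
      b * (((suc k + d) C s) * b ^ d) ≡⟨ x∙yz≈y∙xz b ((suc k + d) C s) (b ^ d) ⟩
      ((suc k + d) C s) * (b * b ^ d) ≡⟨ cong (λ m → (m C s) * (b * b ^ d)) (+-suc k d) ⟨
      ((k + suc d) C s) * (b * b ^ d) ∎
      where
      open ≤-Reasoning
      1+k+d≤n : suc k + d ≤ n
      1+k+d≤n = ≤-trans (≤-reflexive (sym (+-suc k d))) k+d≤n
      1+k≤n : suc k ≤ n
      1+k≤n = ≤-trans (s≤s (m≤m+n k d)) 1+k+d≤n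

    [n∸d]Cs*a^d≤nCs*b^d : ∀ {d} → d ≤ n → ((n ∸ d) C s) * a ^ d ≤ (n C s) * b ^ d
    [n∸d]Cs*a^d≤nCs*b^d {d} d≤n =
      subst (λ m → ((n ∸ d) C s) * a ^ d ≤ (m C s) * b ^ d) (m∸n+n≡m d≤n)
            (kCs*a^d≤[k+d]Cs*b^d d (n ∸ d) (≤-reflexive (m∸n+n≡m d≤n)))

  ^-distribʳ-* : ∀ m n o → (m * n) ^ o ≡ m ^ o * n ^ o
  ^-distribʳ-* m n zero    = refl
  ^-distribʳ-* m n (suc o) = trans (cong (m * n *_) (^-distribʳ-* m n o)) (interchange m n (m ^ o) (n ^ o))

  [m^n]^o≡[m^o]^n : ∀ m n o → (m ^ n) ^ o ≡ (m ^ o) ^ n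
  [m^n]^o≡[m^o]^n m n o = trans (^-*-assoc m n o) (trans (cong (m ^_) (*-comm n o)) (sym (^-*-assoc m o n)))

  ^-cancelˡ-≤ : ∀ o .{{_ : NonZero o}} {m n} → m ^ o ≤ n ^ o → m ≤ n
  ^-cancelˡ-≤ o le = ≮⇒≥ (λ n<m → <⇒≱ (^-monoˡ-< o n<m) le)

  x^k*[x+k]≤[1+x]^k*x : ∀ x k → x ^ k * (x + k) ≤ suc x ^ k * x
  x^k*[x+k]≤[1+x]^k*x x zero    = ≤-reflexive (cong (1 *_) (+-identityʳ x))
  x^k*[x+k]≤[1+x]^k*x x (suc k) = begin
    x * x ^ k * (x + suc k)      ≡⟨ xy∙z≈y∙xz x (x ^ k) (x + suc k) ⟩
    x ^ k * (x * (x + suc k))    ≤⟨ *-monoʳ-≤ (x ^ k) (≤-trans (m≤m+n _ k) (≤-reflexive (expand x k))) ⟩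
    x ^ k * ((x + k) * suc x)    ≡⟨ *-assoc (x ^ k) (x + k) (suc x) ⟨
    x ^ k * (x + k) * suc x      ≤⟨ *-monoˡ-≤ (suc x) (x^k*[x+k]≤[1+x]^k*x x k) ⟩
    suc x ^ k * x * suc x        ≡⟨ xy∙z≈xz∙y (suc x ^ k) x (suc x) ⟩
    suc x ^ k * suc x * x        ≡⟨ cong (_* x) (*-comm (suc x ^ k) (suc x)) ⟩
    suc x * suc x ^ k * x        ∎
    where
    open ≤-Reasoning
    expand : ∀ x k → x * (x + suc k) + k ≡ (x + k) * suc x
    expand = solve-∀

  2*x^a≤[1+x]^a : ∀ {x a} → 1 ≤ x → x ≤ a → 2 * x ^ a ≤ suc x ^ a
  2*x^a≤[1+x]^a {x} {a} 1≤x x≤a = *-cancelʳ-≤ (2 * x ^ a) (suc x ^ a) x {{>-nonZero 1≤x}} (begin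
    2 * x ^ a * x   ≡⟨ xy∙z≈y∙xz 2 (x ^ a) x ⟩
    x ^ a * (2 * x) ≤⟨ *-monoʳ-≤ (x ^ a) (+-monoʳ-≤ x (≤-trans (≤-reflexive (+-identityʳ x)) x≤a)) ⟩
    x ^ a * (x + a) ≤⟨ x^k*[x+k]≤[1+x]^k*x x a ⟩
    suc x ^ a * x   ∎)
    where open ≤-Reasoning

  2^t*x^a≤[t+x]^a : ∀ t {x a} → 1 ≤ x → t + x ≤ a → 2 ^ t * x ^ a ≤ (t + x) ^ a
  2^t*x^a≤[t+x]^a zero    {x} {a} _   _     = ≤-reflexive (*-identityˡ (x ^ a))
  2^t*x^a≤[t+x]^a (suc t) {x} {a} 1≤x t+x≤a = begin
    2 * 2 ^ t * x ^ a   ≡⟨ xy∙z≈y∙xz 2 (2 ^ t) (x ^ a) ⟩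
    2 ^ t * (2 * x ^ a) ≤⟨ *-monoʳ-≤ (2 ^ t) (2*x^a≤[1+x]^a 1≤x (≤-trans (m≤n+m x (suc t)) t+x≤a)) ⟩
    2 ^ t * suc x ^ a   ≤⟨ 2^t*x^a≤[t+x]^a t (s≤s z≤n) (≤-trans (≤-reflexive (+-suc t x)) t+x≤a) ⟩
    (t + suc x) ^ a     ≡⟨ cong (_^ a) (+-suc t x) ⟩
    suc (t + x) ^ a     ∎
    where open ≤-Reasoning

  N³*b^d≤[b+t]^d : ∀ {N b t d} → 1 ≤ b → N ^ (3 * (b + t)) ≤ 2 ^ (d * t) → N ^ 3 * b ^ d ≤ (b + t) ^ d
  N³*b^d≤[b+t]^d {N} {b} {t} {d} 1≤b N^3a≤2^dt = ^-cancelˡ-≤ a {{>-nonZero a≥1}} (begin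
    (N ^ 3 * b ^ d) ^ a        ≡⟨ ^-distribʳ-* (N ^ 3) (b ^ d) a ⟩
    (N ^ 3) ^ a * (b ^ d) ^ a  ≡⟨ cong₂ _*_ (^-*-assoc N 3 a) ([m^n]^o≡[m^o]^n b d a) ⟩
    N ^ (3 * a) * (b ^ a) ^ d  ≤⟨ *-monoˡ-≤ ((b ^ a) ^ d) N^3a≤2^dt ⟩
    2 ^ (d * t) * (b ^ a) ^ d  ≡⟨ cong (_* (b ^ a) ^ d) (trans ([m^n]^o≡[m^o]^n 2 t d) (^-*-assoc 2 d t)) ⟨
    (2 ^ t) ^ d * (b ^ a) ^ d  ≡⟨ ^-distribʳ-* (2 ^ t) (b ^ a) d ⟨
    (2 ^ t * b ^ a) ^ d        ≤⟨ ^-monoˡ-≤ d 2^t*b^a≤a^a ⟩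
    (a ^ a) ^ d                ≡⟨ [m^n]^o≡[m^o]^n a a d ⟩
    (a ^ d) ^ a                ∎)
    where
    open ≤-Reasoning
    a = b + t
    a≥1 : 1 ≤ a
    a≥1 = ≤-trans 1≤b (m≤m+n b t)
    2^t*b^a≤a^a : 2 ^ t * b ^ a ≤ a ^ a
    2^t*b^a≤a^a = subst (λ m → 2 ^ t * b ^ a ≤ m ^ a) (+-comm t b)
                        (2^t*x^a≤[t+x]^a t 1≤b (≤-reflexive (+-comm t b)))

  N³*[n∸d]Cs≤nCs : ∀ {N n s d b t} → d ≤ n → 1 ≤ b → n * t ≤ s * (b + t) →
    N ^ (3 * (b + t)) ≤ 2 ^ (d * t) → N ^ 3 * ((n ∸ d) C s) ≤ n C s
  N³*[n∸d]Cs≤nCs {N} {n} {s} {d} {b} {t} d≤n 1≤b nt≤sa N^3a≤2^dt =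
    *-cancelʳ-≤ (N ^ 3 * ((n ∸ d) C s)) (n C s) (a ^ d) {{m^n≢0 a d {{>-nonZero a≥1}}}} (begin
      N ^ 3 * ((n ∸ d) C s) * a ^ d    ≡⟨ *-assoc (N ^ 3) ((n ∸ d) C s) (a ^ d) ⟩
      N ^ 3 * (((n ∸ d) C s) * a ^ d)
        ≤⟨ *-monoʳ-≤ (N ^ 3) ([n∸d]Cs*a^d≤nCs*b^d {s = s} {a} [n∸s]*a≤n*b d≤n) ⟩
      N ^ 3 * ((n C s) * b ^ d)        ≡⟨ x∙yz≈y∙xz (N ^ 3) (n C s) (b ^ d) ⟩
      (n C s) * (N ^ 3 * b ^ d)
        ≤⟨ *-monoʳ-≤ (n C s) (N³*b^d≤[b+t]^d {d = d} 1≤b N^3a≤2^dt) ⟩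
      (n C s) * a ^ d                  ∎)
    where
    open ≤-Reasoning
    a = b + t
    a≥1 : 1 ≤ a
    a≥1 = ≤-trans 1≤b (m≤m+n b t)
    [n∸s]*a≤n*b : (n ∸ s) * a ≤ n * b
    [n∸s]*a≤n*b = begin
      (n ∸ s) * a     ≡⟨ *-distribʳ-∸ a n s ⟩
      n * a ∸ s * a   ≤⟨ ∸-monoʳ-≤ (n * a) nt≤sa ⟩
      n * a ∸ n * t   ≡⟨ *-distribˡ-∸ n a t ⟨
      n * (a ∸ t)     ≡⟨ cong (n *_) (m+n∸n≡m b t) ⟩
      n * b           ∎

module ClearingDenominators where

  open import Data.Nat.Base as ℕ using (ℕ; suc; _*_; _≤_)
  import Data.Nat.Properties as ℕ
  open import Data.Integer.Base as ℤ using (+_; +[1+_]; -[1+_])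
  import Data.Integer.Properties as ℤ
  open import Data.Integer.DivMod using ([n/d]*d≤n)
  open import Data.Rational.Base as ℚ using (mkℚ; ↥_; ↧_; 1ℚ; floor; ceiling; _÷_)
  import Data.Rational.Properties as ℚ
  open import Data.Rational.Unnormalised.Base as ℚᵘ using (ℚᵘ; mkℚᵘ; *≤*; *≡*)
    renaming (_≤_ to _≤ᵘ_; _≃_ to _≃ᵘ_)
  import Data.Rational.Unnormalised.Properties as ℚᵘ
  open import Data.Nat.Coprimality using (Coprime)
  open import Relation.Binary.PropositionalEquality
  import Algebra.Properties.CommutativeSemigroup ℤ.*-commutativeSemigroup as ℤ*
  open import Relation.Binary.Reasoning.Setoid ℚᵘ.≃-setoid as ≃-Reasoning using ()

  infixl 7 _/ᵘ_

  private instance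
    *-nonZero : ∀ {m n} .{{_ : ℕ.NonZero m}} .{{_ : ℕ.NonZero n}} → ℕ.NonZero (m * n)
    *-nonZero {m} {n} = ℕ.m*n≢0 m n

  -- Rational inequalities are moved to ℚᵘ, where products are not normalised,
  -- and read off as inequalities between cross-products of naturals.
  _/ᵘ_ : ℕ → (d : ℕ) → .{{ℕ.NonZero d}} → ℚᵘ
  a /ᵘ d = + a ℚᵘ./ d

  /ᵘ-≤⁻ : ∀ {a b c d} .{{_ : ℕ.NonZero b}} .{{_ : ℕ.NonZero d}} → a /ᵘ b ≤ᵘ c /ᵘ d → a * d ≤ c * b
  /ᵘ-≤⁻ {a} {b@(suc _)} {c} {d@(suc _)} (*≤* le) =
    ℤ.drop‿+≤+ (subst₂ ℤ._≤_ (sym (ℤ.pos-* a d)) (sym (ℤ.pos-* c b)) le)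

  /ᵘ-≤⁺ : ∀ {a b c d} .{{_ : ℕ.NonZero b}} .{{_ : ℕ.NonZero d}} → a * d ≤ c * b → a /ᵘ b ≤ᵘ c /ᵘ d
  /ᵘ-≤⁺ {a} {b@(suc _)} {c} {d@(suc _)} le =
    *≤* (subst₂ ℤ._≤_ (ℤ.pos-* a d) (ℤ.pos-* c b) (ℤ.+≤+ le))

  /ᵘ-*-/ᵘ : ∀ a b c d .{{_ : ℕ.NonZero b}} .{{_ : ℕ.NonZero d}} →
    (a /ᵘ b) ℚᵘ.* (c /ᵘ d) ≃ᵘ (a * c) /ᵘ (b * d)
  /ᵘ-*-/ᵘ a (suc b) c (suc d) =
    ℚᵘ.≃-reflexive (cong (λ z → mkℚᵘ z (d ℕ.+ b * suc d)) (sym (ℤ.pos-* a c)))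

  toℚᵘ-toℚ : ∀ k → ℚ.toℚᵘ (toℚ k) ≃ᵘ k /ᵘ 1
  toℚᵘ-toℚ k = ℚ.toℚᵘ-fromℚᵘ (k /ᵘ 1)

  toℚᵘ-*-toℚ : ∀ x k → ℚ.toℚᵘ (x ℚ.* toℚ k) ≃ᵘ ℚ.toℚᵘ x ℚᵘ.* (k /ᵘ 1)
  toℚᵘ-*-toℚ x k =
    ℚᵘ.≃-trans (ℚ.toℚᵘ-homo-* x (toℚ k)) (ℚᵘ.*-congˡ {ℚ.toℚᵘ x} (toℚᵘ-toℚ k))

  module _ {p q-1 : ℕ} .{cop : Coprime p (suc q-1)} where

    private
      c = mkℚ (+ p) q-1 cop
      q = suc q-1

    1≤c⇒q≤p : 1ℚ ℚ.≤ c → q ≤ p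
    1≤c⇒q≤p h = subst₂ _≤_ (ℕ.*-identityˡ q) (ℕ.*-identityʳ p) (/ᵘ-≤⁻ (ℚ.toℚᵘ-mono-≤ h))

    toℚ≤c*toℚ⇒*≤* : ∀ A B → toℚ A ℚ.≤ c ℚ.* toℚ B → A * q ≤ p * B
    toℚ≤c*toℚ⇒*≤* A B h =
      subst₂ _≤_ (cong (A *_) (ℕ.*-identityʳ q)) (ℕ.*-identityʳ (p * B)) (/ᵘ-≤⁻ (begin
      A /ᵘ 1                  ≃⟨ toℚᵘ-toℚ A ⟨
      ℚ.toℚᵘ (toℚ A)          ≤⟨ ℚ.toℚᵘ-mono-≤ h ⟩
      ℚ.toℚᵘ (c ℚ.* toℚ B)    ≃⟨ toℚᵘ-*-toℚ c B ⟩
      (p /ᵘ q) ℚᵘ.* (B /ᵘ 1)  ≃⟨ /ᵘ-*-/ᵘ p q B 1 ⟩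
      (p * B) /ᵘ (q * 1)      ∎))
      where open ℚᵘ.≤-Reasoning

    *≤*⇒toℚ*toℚ≤c*c*toℚ : ∀ X N T → X * N * (q * q) ≤ p * p * T →
      toℚ X ℚ.* toℚ N ℚ.≤ (c ℚ.* c) ℚ.* toℚ T
    *≤*⇒toℚ*toℚ≤c*c*toℚ X N T le = ℚ.toℚᵘ-cancel-≤ (begin
      ℚ.toℚᵘ (toℚ X ℚ.* toℚ N)                 ≃⟨ toℚᵘ-*-toℚ (toℚ X) N ⟩
      ℚ.toℚᵘ (toℚ X) ℚᵘ.* (N /ᵘ 1)             ≃⟨ ℚᵘ.*-congʳ (toℚᵘ-toℚ X) ⟩
      (X /ᵘ 1) ℚᵘ.* (N /ᵘ 1)                   ≃⟨ /ᵘ-*-/ᵘ X 1 N 1 ⟩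
      (X * N) /ᵘ 1                             ≤⟨ /ᵘ-≤⁺ le′ ⟩
      (p * p * T) /ᵘ (q * q * 1)               ≃⟨ /ᵘ-*-/ᵘ (p * p) (q * q) T 1 ⟨
      ((p * p) /ᵘ (q * q)) ℚᵘ.* (T /ᵘ 1)       ≃⟨ ℚᵘ.*-congʳ (/ᵘ-*-/ᵘ p q p q) ⟨
      ((p /ᵘ q) ℚᵘ.* (p /ᵘ q)) ℚᵘ.* (T /ᵘ 1)   ≃⟨ ℚᵘ.*-congʳ (ℚ.toℚᵘ-homo-* c c) ⟨
      ℚ.toℚᵘ (c ℚ.* c) ℚᵘ.* (T /ᵘ 1)           ≃⟨ toℚᵘ-*-toℚ (c ℚ.* c) T ⟨
      ℚ.toℚᵘ ((c ℚ.* c) ℚ.* toℚ T)             ∎)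
      where
      open ℚᵘ.≤-Reasoning
      le′ : X * N * (q * q * 1) ≤ p * p * T * 1
      le′ = subst₂ _≤_ (cong (X * N *_) (sym (ℕ.*-identityʳ (q * q)))) (sym (ℕ.*-identityʳ (p * p * T))) le

  floor*↧≤↥ : ∀ x → floor x ℤ.* ↧ x ℤ.≤ ↥ x
  floor*↧≤↥ x@record{} = [n/d]*d≤n (↥ x) (↧ x)

  ↥≤ceiling*↧ : ∀ x → ↥ x ℤ.≤ ceiling x ℤ.* ↧ x
  ↥≤ceiling*↧ x@record{} = begin
    ↥ x                           ≡⟨ ℤ.neg-involutive (↥ x) ⟨
    ℤ.- (ℤ.- ↥ x)                 ≤⟨ ℤ.neg-mono-≤ floor[-x]*↧x≤-↥x ⟩
    ℤ.- (floor (ℚ.- x) ℤ.* ↧ x)   ≡⟨ ℤ.neg-distribˡ-* (floor (ℚ.- x)) (↧ x) ⟩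
    ceiling x ℤ.* ↧ x             ∎
    where
    open ℤ.≤-Reasoning
    floor[-x]*↧x≤-↥x : floor (ℚ.- x) ℤ.* ↧ x ℤ.≤ ℤ.- ↥ x
    floor[-x]*↧x≤-↥x =
      subst₂ ℤ._≤_ (cong (floor (ℚ.- x) ℤ.*_) (ℚ.↧-neg x)) (ℚ.↥-neg x) (floor*↧≤↥ (ℚ.- x))

  ≃/ᵘ⇒≤∣ceiling∣* : ∀ x {M D} .{{_ : ℕ.NonZero D}} →
    ℚ.toℚᵘ x ≃ᵘ M /ᵘ D → M ≤ ℤ.∣ ceiling x ∣ * D
  ≃/ᵘ⇒≤∣ceiling∣* x@record{} {M} {D@(suc _)} (*≡* ↥x*D≡M*↧x) =
    +≤⇒≤∣∣* (ceiling x) M≤ceiling*D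
    where
    M≤ceiling*D : + M ℤ.≤ ceiling x ℤ.* + D
    M≤ceiling*D = ℤ.*-cancelʳ-≤-pos (+ M) (ceiling x ℤ.* + D) (↧ x) (begin
      + M ℤ.* ↧ x                 ≡⟨ ↥x*D≡M*↧x ⟨
      ↥ x ℤ.* + D                 ≤⟨ ℤ.*-monoʳ-≤-nonNeg (+ D) (↥≤ceiling*↧ x) ⟩
      ceiling x ℤ.* ↧ x ℤ.* + D   ≡⟨ ℤ*.xy∙z≈xz∙y (ceiling x) (↧ x) (+ D) ⟩
      ceiling x ℤ.* + D ℤ.* ↧ x   ∎)
      where open ℤ.≤-Reasoning
    +≤⇒≤∣∣* : ∀ z → + M ℤ.≤ z ℤ.* + D → M ≤ ℤ.∣ z ∣ * D
    +≤⇒≤∣∣* (+ k) le = ℤ.drop‿+≤+ (subst (+ M ℤ.≤_) (sym (ℤ.pos-* k D)) le)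
    +≤⇒≤∣∣* -[1+ k ] ()

  module _ {p-1 q-1 : ℕ} .{cop : Coprime (suc p-1) (suc q-1)} where

    private
      c = mkℚ +[1+ p-1 ] q-1 cop
      p = suc p-1
      q = suc q-1

    n*q²≤wsize*2p² : ∀ (h : 1ℚ ℚ.≤ c) n → n * (q * q) ≤ wsize n c h * (2 * (p * p))
    n*q²≤wsize*2p² h n = subst₂ _≤_ lhs rhs (≃/ᵘ⇒≤∣ceiling∣* x x≃)
      where
      x = ((toℚ n ÷ c) ÷ c) ÷ toℚ 2
      open ≃-Reasoning
      x≃ : ℚ.toℚᵘ x ≃ᵘ (n * q * q * 1) /ᵘ (1 * p * p * 2)
      x≃ = begin
        ℚ.toℚᵘ x
          ≈⟨ ℚ.toℚᵘ-homo-* ((toℚ n ÷ c) ÷ c) (ℚ.1/ toℚ 2) ⟩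
        ℚ.toℚᵘ ((toℚ n ÷ c) ÷ c) ℚᵘ.* (1 /ᵘ 2)
          ≈⟨ ℚᵘ.*-congʳ (ℚ.toℚᵘ-homo-* (toℚ n ÷ c) (ℚ.1/ c)) ⟩
        (ℚ.toℚᵘ (toℚ n ÷ c) ℚᵘ.* (q /ᵘ p)) ℚᵘ.* (1 /ᵘ 2)
          ≈⟨ ℚᵘ.*-congʳ (ℚᵘ.*-congʳ (ℚᵘ.≃-trans (ℚ.toℚᵘ-homo-* (toℚ n) (ℚ.1/ c))
                                                 (ℚᵘ.*-congʳ (toℚᵘ-toℚ n)))) ⟩
        (((n /ᵘ 1) ℚᵘ.* (q /ᵘ p)) ℚᵘ.* (q /ᵘ p)) ℚᵘ.* (1 /ᵘ 2)
          ≈⟨ ℚᵘ.*-congʳ (ℚᵘ.≃-trans (ℚᵘ.*-congʳ (/ᵘ-*-/ᵘ n 1 q p))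
                                    (/ᵘ-*-/ᵘ (n * q) (1 * p) q p)) ⟩
        ((n * q * q) /ᵘ (1 * p * p)) ℚᵘ.* (1 /ᵘ 2)
          ≈⟨ /ᵘ-*-/ᵘ (n * q * q) (1 * p * p) 1 2 ⟩
        (n * q * q * 1) /ᵘ (1 * p * p * 2)
          ∎
      lhs : n * q * q * 1 ≡ n * (q * q)
      lhs = trans (ℕ.*-identityʳ (n * q * q)) (ℕ.*-assoc n q q)
      rhs : wsize n c h * (1 * p * p * 2) ≡ wsize n c h * (2 * (p * p))
      rhs = cong (wsize n c h *_)
                 (trans (ℕ.*-comm (1 * p * p) 2) (cong (λ z → 2 * (z * p)) (ℕ.*-identityˡ p)))

module UnionBound where

  open Counting
  open SubsetCounting
  open Binomial
  open import Function.Base using (_∘_; id)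
  open import Function.Bundles using (Equivalence)
  open import Data.Bool.Base using (Bool; _∧_; _xor_; T)
  open import Data.Bool.ListAction using (any)
  import Data.Bool.Properties as Bool
  open import Data.Product.Base using (_,_)
  open import Data.Nat.Base
  open import Data.Nat.Properties
  open import Data.Nat.Combinatorics using (_C_)
  open import Data.Rational.Base using (ℚ)
  open import Data.Fin.Base using (zero; suc)
  open import Data.Fin.Subset using (Subset; ⊤; _∩_; ∣_∣)
  open import Data.Fin.Subset.Properties using (∣p∣≤n; ∣⊤∣≡n)
  open import Data.Vec.Base as Vec using ([]; _∷_)
  open import Data.Vec.Properties using (≡-dec)
  open import Data.List.Base as List using (List; _∷_; map; foldr; length; deduplicate; allFin)
  open import Data.List.Membership.Propositional using (_∈_; lose)
  open import Data.List.Membership.Propositional.Properties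
    using (∈-map⁺; ∈-filter⁺; ∈-deduplicate⁺; ∈-allFin)
  open import Data.List.Relation.Unary.Any using (here; there; satisfied)
  open import Data.List.Relation.Unary.Any.Properties using (any⁺; any⁻)
  open import Relation.Binary.PropositionalEquality
  open import Data.Nat.Tactic.RingSolver using (solve-∀)
  open import Relation.Nullary.Decidable using (toWitness)

  private
    variable
      n m : ℕ

  trace-∩ : ∀ (E : Adj n m) W b → trace E W b ≡ W ∩ trace E ⊤ b
  trace-∩ E []      b = refl
  trace-∩ E (w ∷ W) b = cong ((w ∧ E zero b) ∷_) (trace-∩ (E ∘ suc) W b)

  trace-⊤-△ : ∀ (E : Adj n m) b b′ →
    trace E ⊤ b △ trace E ⊤ b′ ≡ Vec.tabulate (λ a → E a b xor E a b′)
  trace-⊤-△ {zero}  E b b′ = refl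
  trace-⊤-△ {suc n} E b b′ = cong ((E zero b xor E zero b′) ∷_) (trace-⊤-△ (E ∘ suc) b b′)

  symDiff≡∣△∣ : ∀ (E : Adj n m) b b′ → symDiff E b b′ ≡ ∣ trace E ⊤ b △ trace E ⊤ b′ ∣
  symDiff≡∣△∣ E b b′ =
    trans (count-tabulate (λ a → E a b xor E a b′) id) (cong ∣_∣ (sym (trace-⊤-△ E b b′)))

  ∈⇒≤foldr-⊔ : ∀ {x xs} → x ∈ xs → x ≤ foldr _⊔_ 0 xs
  ∈⇒≤foldr-⊔ {x} (here refl)         = m≤m⊔n x _
  ∈⇒≤foldr-⊔ {xs = y ∷ _} (there x∈) = ≤-trans (∈⇒≤foldr-⊔ x∈) (m≤n⊔m y _)

  twinClassesB≤π : ∀ (E : Adj n m) {W k} → ∣ W ∣ ≤ k → twinClassesB E W ≤ π E k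
  twinClassesB≤π E {W} {k} ∣W∣≤k =
    ∈⇒≤foldr-⊔ (∈-map⁺ (twinClassesB E) (∈-filter⁺ (λ A → ∣ A ∣ ≤? k) (∈-allSubsets W) ∣W∣≤k))

  neighbourhoods : Adj n m → List (Subset n)
  neighbourhoods {m = m} E = deduplicate (≡-dec Bool._≟_) (map (trace E ⊤) (allFin m))

  ∈-neighbourhoods : ∀ (E : Adj n m) b → trace E ⊤ b ∈ neighbourhoods E
  ∈-neighbourhoods E b = ∈-deduplicate⁺ (≡-dec Bool._≟_) (∈-map⁺ (trace E ⊤) (∈-allFin b))

  farAndAgreeing : ℚ → ℕ → ℕ → Subset n → Subset n → Subset n → Bool
  farAndAgreeing c N s X Y W = logBoundᵇ c N ∣ X △ Y ∣ ∧ (sized s W ∧ agreeOn W X Y)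

  bad⇒farAndAgreeing : ∀ (E : Adj n m) c N s W → T (sized s W ∧ badᵇ E c N W) →
    T (any (λ X → any (λ Y → farAndAgreeing c N s X Y W) (neighbourhoods E)) (neighbourhoods E))
  bad⇒farAndAgreeing {m = m} E c N s W sized∧bad =
    let sizedW , badW = Equivalence.to Bool.T-∧ sized∧bad
        b  , t        = satisfied (any⁻ _ (allFin m) badW)
        b′ , agree∧far = satisfied (any⁻ _ (allFin m) t)
        agree , far   = Equivalence.to Bool.T-∧ agree∧far
        W∩X≡W∩Y       = trans (sym (trace-∩ E W b)) (trans (toWitness agree) (trace-∩ E W b′))
    in any⁺ _ (lose (∈-neighbourhoods E b) (any⁺ _ (lose (∈-neighbourhoods E b′)
         (Equivalence.from Bool.T-∧ (subst (T ∘ logBoundᵇ c N) (symDiff≡∣△∣ E b b′) far ,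
                                     Equivalence.from Bool.T-∧ (sizedW , agreeOn⁺ W∩X≡W∩Y))))))

  badCount*N³≤K*[K*T] : ∀ (E : Adj n m) c N s →
    (∀ d → d ≤ n → T (logBoundᵇ c N d) → N ^ 3 * ((n ∸ d) C s) ≤ n C s) →
    badCount E c N s * N ^ 3 ≤ twinClassesB E ⊤ * (twinClassesB E ⊤ * length (subsetsOfSize n s))
  badCount*N³≤K*[K*T] {n} E c N s far⇒rare = begin
    badCount E c N s * N ^ 3
      ≡⟨ cong (_* N ^ 3) (count-filter (λ W → ∣ W ∣ ≟ s) (badᵇ E c N) S) ⟩
    count (λ W → sized s W ∧ badᵇ E c N W) S * N ^ 3
      ≤⟨ *-monoˡ-≤ (N ^ 3) (count-mono (bad⇒farAndAgreeing E c N s) S) ⟩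
    count (λ W → any (λ X → any (λ Y → farAndAgreeing c N s X Y W) L) L) S * N ^ 3
      ≤⟨ count-any-≤ _ L S (λ X → count-any-≤ _ L S (farAndAgreeing-rare X)) ⟩
    length L * (length L * length (subsetsOfSize n s)) ∎
    where
    open ≤-Reasoning
    S = allSubsets n
    L = neighbourhoods E
    farAndAgreeing-rare : ∀ X Y → count (farAndAgreeing c N s X Y) S * N ^ 3 ≤ length (subsetsOfSize n s)
    farAndAgreeing-rare X Y = count-∧ˡ-≤ (logBoundᵇ c N ∣ X △ Y ∣) _ S λ far → begin
      count (λ W → sized s W ∧ agreeOn W X Y) S * N ^ 3 ≡⟨ cong (_* N ^ 3) (count-sized-agreeOn n X Y s) ⟩
      ((n ∸ ∣ X △ Y ∣) C s) * N ^ 3                      ≡⟨ *-comm ((n ∸ ∣ X △ Y ∣) C s) (N ^ 3) ⟩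
      N ^ 3 * ((n ∸ ∣ X △ Y ∣) C s)                      ≤⟨ far⇒rare ∣ X △ Y ∣ (∣p∣≤n (X △ Y)) far ⟩
      n C s                                              ≡⟨ count-sized n s ⟨
      count (sized s) S                                  ≡⟨ length-filter≡count (λ W → ∣ W ∣ ≟ s) S ⟨
      length (subsetsOfSize n s)                         ∎

  badCount*N*q²≤p²*T : ∀ (E : Adj n m) c {N s p q} → n ≤ N → 1 ≤ N → 1 ≤ q → q ≤ p →
    (∀ d → T (logBoundᵇ c N d) → N ^ (6 * p * p) ≤ 2 ^ (d * q * q)) →
    n * (q * q) ≤ s * (2 * (p * p)) → π E N * q ≤ p * N →
    badCount E c N s * N * (q * q) ≤ p * p * length (subsetsOfSize n s)
  badCount*N*q²≤p²*T {n} E c {N} {s} {p} {q} n≤N 1≤N 1≤q q≤p far⇒N^6p²≤2^dq² nq²≤2sp² π≤cN =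
    *-cancelʳ-≤ (B * N * (q * q)) (p * p * Tot) (N * N) {{>-nonZero (*-mono-≤ 1≤N 1≤N)}} (begin
      B * N * (q * q) * (N * N)   ≡⟨ regroupˡ B N (q * q) ⟩
      B * N ^ 3 * (q * q)         ≤⟨ *-monoˡ-≤ (q * q) (badCount*N³≤K*[K*T] E c N s far⇒rare) ⟩
      K * (K * Tot) * (q * q)     ≡⟨ regroupᵐ K Tot q ⟩
      K * q * (K * q) * Tot       ≤⟨ *-monoˡ-≤ Tot (*-mono-≤ Kq≤pN Kq≤pN) ⟩
      p * N * (p * N) * Tot       ≡⟨ regroupʳ p N Tot ⟩
      p * p * Tot * (N * N)       ∎)
    where
    open ≤-Reasoning
    B = badCount E c N s
    K = twinClassesB E ⊤
    Tot = length (subsetsOfSize n s)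
    t = q * q
    a = 2 * (p * p)
    b = a ∸ t
    t≤pp : t ≤ p * p
    t≤pp = *-mono-≤ q≤p q≤p
    pp≥1 : 1 ≤ p * p
    pp≥1 = *-mono-≤ (≤-trans 1≤q q≤p) (≤-trans 1≤q q≤p)
    t<a : t < a
    t<a = ≤-<-trans t≤pp (subst (p * p <_) (cong (p * p +_) (sym (+-identityʳ (p * p)))) (m<m+n (p * p) pp≥1))
    b+t≡a : b + t ≡ a
    b+t≡a = m∸n+n≡m (<⇒≤ t<a)
    far⇒rare : ∀ d → d ≤ n → T (logBoundᵇ c N d) → N ^ 3 * ((n ∸ d) C s) ≤ n C s
    far⇒rare d d≤n far = N³*[n∸d]Cs≤nCs {s = s} d≤n (m<n⇒0<n∸m t<a)
      (subst (λ x → n * t ≤ s * x) (sym b+t≡a) nq²≤2sp²)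
      (subst₂ (λ e f → N ^ e ≤ 2 ^ f) exponent (*-assoc d q q) (far⇒N^6p²≤2^dq² d far))
      where
      exponent : 6 * p * p ≡ 3 * (b + t)
      exponent = trans (*-assoc 6 p p) (trans (*-assoc 3 2 (p * p)) (cong (3 *_) (sym b+t≡a)))
    Kq≤pN : K * q ≤ p * N
    Kq≤pN = ≤-trans (*-monoˡ-≤ q (twinClassesB≤π E {W = ⊤} ∣⊤∣≤N)) π≤cN
      where
      ∣⊤∣≤N : ∣ ⊤ {n = n} ∣ ≤ N
      ∣⊤∣≤N = ≤-trans (≤-reflexive (∣⊤∣≡n n)) n≤N
    regroupˡ : ∀ x y z → x * y * z * (y * y) ≡ x * (y * (y * (y * 1))) * z
    regroupˡ = solve-∀
    regroupᵐ : ∀ x y z → x * (x * y) * (z * z) ≡ x * z * (x * z) * y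
    regroupᵐ = solve-∀
    regroupʳ : ∀ x y z → x * y * (x * y) * z ≡ x * x * z * (y * y)
    regroupʳ = solve-∀

open ClearingDenominators
open UnionBound using (badCount*N*q²≤p²*T)
open import Data.Empty using (⊥-elim)
open import Data.Bool.Base using (T)
open import Data.Product.Base using (_,_; proj₁)
open import Data.Nat.Base using (ℕ; suc; _≤_; s≤s; z≤n; _^_)
import Data.Nat.Base as ℕ
open import Data.Nat.Properties using (≤ᵇ⇒≤; n≮0)
open import Data.Integer.Base using (+_; +[1+_]; -[1+_])
open import Data.Rational.Base using (ℚ; mkℚ; *≤*; _*_) renaming (_≤_ to _≤ℚ_)
open import Data.List.Base using (length)

lemma16 : ∀ {n m} (E : Adj n m) (c : ℚ) (lin : IsLinearity E c) (N : ℕ) →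
    n ≤ N → 1 ≤ N →
    toℚ (badCount E c N (wsize n c (proj₁ lin))) * toℚ N
      ≤ℚ (c * c) * toℚ (length (subsetsOfSize n (wsize n c (proj₁ lin))))
lemma16 E (mkℚ -[1+ _ ] _ _) (*≤* () , _) N _ _
lemma16 E (mkℚ (+ 0) _ _) (1≤c , _) N _ _ = ⊥-elim (n≮0 (1≤c⇒q≤p 1≤c))
lemma16 {n} E c@(mkℚ +[1+ p-1 ] q-1 cop) (1≤c , linear , _) N n≤N 1≤N =
  *≤*⇒toℚ*toℚ≤c*c*toℚ {cop = cop} (badCount E c N s) N (length (subsetsOfSize n s))
    (badCount*N*q²≤p²*T E c n≤N 1≤N (s≤s z≤n) (1≤c⇒q≤p 1≤c) far⇒N^6p²≤2^dq²
      (n*q²≤wsize*2p² 1≤c n)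
      (toℚ≤c*toℚ⇒*≤* (π E N) N (proj₁ (linear N 1≤N))))
  where
  s = wsize n c 1≤c
  p = suc p-1
  q = suc q-1
  far⇒N^6p²≤2^dq² : ∀ d → T (logBoundᵇ c N d) → N ^ (6 ℕ.* p ℕ.* p) ≤ 2 ^ (d ℕ.* q ℕ.* q)
  far⇒N^6p²≤2^dq² d = ≤ᵇ⇒≤ (N ^ (6 ℕ.* p ℕ.* p)) (2 ^ (d ℕ.* q ℕ.* q))
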